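{- Let $(s(n))_{n\geq 1}$ be the integer sequence defined by $s(1)=0$, $s(2)=1$, $s(3)=1$ and, for all $k\geq 1$, \[ s(4k) = 2s(2k) - s(k),\quad s(4k+1) = 2s(2k) + s(2k+1),\quad s(4k+2) = 2s(2k+1) + s(2k),\quad s(4k+3) = 2s(2k+1) - s(k). \] Then for every integer $n\geq 0$, \[ \frac{1}{2^n} \sum_{2^n \leq t < 2^{n+1}} s(t) = \frac{(5 + \sqrt{17})^n - (5 - \sqrt{17})^n}{2^{2n - 1} \sqrt{17}}. \] -}

module Defs where

open import Data.Nat using (ℕ; zero; suc)
open import Data.Integer using (ℤ; +_) renaming (_+_ to _+ℤ_; _*_ to _*ℤ_; -_ to -ℤ_)
open import Data.List using (List; []; _∷_; map; upTo; foldr)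

-- Exact arithmetic in the ring ℤ[√17]: mk√ a b stands for a + b·√17.
record ℤ√17 : Set where
  constructor mk√
  field
    re : ℤ
    im : ℤ
open ℤ√17 public

infixl 6 _⊕_ _⊖_
infixl 7 _⊛_

_⊕_ : ℤ√17 → ℤ√17 → ℤ√17
(mk√ a b) ⊕ (mk√ c d) = mk√ (a +ℤ c) (b +ℤ d)

⊝_ : ℤ√17 → ℤ√17
⊝ (mk√ a b) = mk√ (-ℤ a) (-ℤ b)

_⊖_ : ℤ√17 → ℤ√17 → ℤ√17
x ⊖ y = x ⊕ (⊝ y)

-- (a + b√17)(c + d√17) = (ac + 17 bd) + (ad + bc)√17
_⊛_ : ℤ√17 → ℤ√17 → ℤ√17
(mk√ a b) ⊛ (mk√ c d) =
  mk√ ((a *ℤ c) +ℤ ((+ 17) *ℤ (b *ℤ d))) ((a *ℤ d) +ℤ (b *ℤ c))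

ι : ℤ → ℤ√17
ι a = mk√ a (+ 0)

√17 : ℤ√17
√17 = mk√ (+ 0) (+ 1)

_^√_ : ℤ√17 → ℕ → ℤ√17
x ^√ zero = ι (+ 1)
x ^√ suc n = x ⊛ (x ^√ n)

sumℤ : List ℤ → ℤ
sumℤ = foldr _+ℤ_ (+ 0)

rangeSum : (ℕ → ℤ) → ℕ → ℕ → ℤ
rangeSum s a len = sumℤ (map (λ i → s (a Data.Nat.+ i)) (upTo len))

-- Summing the four defining relations over a quadruple 4k, …, 4k+3 gives
-- 5 (s(2k) + s(2k+1)) − 2 s(k).  Cutting the dyadic block [2^(n+2), 2^(n+3))
-- into such quadruples shows that the block sums S n satisfy
-- S (n+2) = 5 S (n+1) − 2 S n, hence 2^n S n satisfies x (n+2) = 10 x (n+1) − 8 x n.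
-- That is the recurrence of the √17-coordinate of (5 + √17)^n, whose trace is 10
-- and norm is 8; comparing initial values gives 2^n S n = 4 · im ((5 + √17)^n),
-- and im y · 2√17 = y − ȳ.
module Submission where

open import Defs
open import Data.Nat using (ℕ; zero; suc; _+_; _*_; _^_; _≤_; _≥_)
import Data.Nat.Properties as ℕₚ
open import Data.Integer using (ℤ; +_) renaming (_+_ to _+ℤ_; _-_ to _-ℤ_; _*_ to _*ℤ_; -_ to -ℤ_)
import Data.Integer.Properties as ℤₚ
open import Data.Integer.Tactic.RingSolver using (solve-∀)
open import Data.List using (map; applyUpTo)
open import Data.Product using (_×_; _,_; proj₁)
open import Function using (_∘_)
open import Relation.Binary.PropositionalEquality using (_≡_; refl; sym; trans; cong; cong₂; module ≡-Reasoning)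
open ≡-Reasoning

intervalSum : (ℕ → ℤ) → ℕ → ℕ → ℤ
intervalSum f a zero    = + 0
intervalSum f a (suc m) = f a +ℤ intervalSum f (suc a) m

intervalSum-shift : ∀ f a b m → intervalSum (λ i → f (a + i)) b m ≡ intervalSum f (a + b) m
intervalSum-shift f a b zero    = refl
intervalSum-shift f a b (suc m) =
  cong (f (a + b) +ℤ_)
    (trans (intervalSum-shift f a (suc b) m) (cong (λ c → intervalSum f c m) (ℕₚ.+-suc a b)))

sumℤ-map-applyUpTo : {A : Set} (g : A → ℤ) (f : ℕ → A) (m : ℕ) →
  sumℤ (map g (applyUpTo f m)) ≡ intervalSum (g ∘ f) 0 m
sumℤ-map-applyUpTo g f zero    = refl
sumℤ-map-applyUpTo g f (suc m) =
  cong (g (f 0) +ℤ_) (trans (sumℤ-map-applyUpTo g (f ∘ suc) m) (intervalSum-shift (g ∘ f) 1 0 m))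

rangeSum≡intervalSum : ∀ f a m → rangeSum f a m ≡ intervalSum f a m
rangeSum≡intervalSum f a m =
  trans (sumℤ-map-applyUpTo (λ i → f (a + i)) (λ i → i) m)
    (trans (intervalSum-shift f a 0 m) (cong (λ b → intervalSum f b m) (ℕₚ.+-identityʳ a)))

intervalSum-++ : ∀ f a l m → intervalSum f a (l + m) ≡ intervalSum f a l +ℤ intervalSum f (a + l) m
intervalSum-++ f a zero    m = begin
  intervalSum f a m                ≡⟨ cong (λ b → intervalSum f b m) (sym (ℕₚ.+-identityʳ a)) ⟩
  intervalSum f (a + 0) m          ≡⟨ sym (ℤₚ.+-identityˡ _) ⟩
  + 0 +ℤ intervalSum f (a + 0) m   ∎
intervalSum-++ f a (suc l) m = begin
  f a +ℤ intervalSum f (suc a) (l + m)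
    ≡⟨ cong (f a +ℤ_) (intervalSum-++ f (suc a) l m) ⟩
  f a +ℤ (intervalSum f (suc a) l +ℤ intervalSum f (suc a + l) m)
    ≡⟨ sym (ℤₚ.+-assoc (f a) _ _) ⟩
  intervalSum f a (suc l) +ℤ intervalSum f (suc a + l) m
    ≡⟨ cong (λ b → intervalSum f a (suc l) +ℤ intervalSum f b m) (sym (ℕₚ.+-suc a l)) ⟩
  intervalSum f a (suc l) +ℤ intervalSum f (a + suc l) m ∎

intervalSum-blocks : ∀ f k a m →
  intervalSum f (k * a) (k * m) ≡ intervalSum (λ j → intervalSum f (k * j) k) a m
intervalSum-blocks f k a zero    = cong (intervalSum f (k * a)) (ℕₚ.*-zeroʳ k)
intervalSum-blocks f k a (suc m) = begin
  intervalSum f (k * a) (k * suc m)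
    ≡⟨ cong (intervalSum f (k * a)) (ℕₚ.*-suc k m) ⟩
  intervalSum f (k * a) (k + k * m)
    ≡⟨ intervalSum-++ f (k * a) k (k * m) ⟩
  intervalSum f (k * a) k +ℤ intervalSum f (k * a + k) (k * m)
    ≡⟨ cong (λ b → intervalSum f (k * a) k +ℤ intervalSum f b (k * m))
            (trans (ℕₚ.+-comm (k * a) k) (sym (ℕₚ.*-suc k a))) ⟩
  intervalSum f (k * a) k +ℤ intervalSum f (k * suc a) (k * m)
    ≡⟨ cong (intervalSum f (k * a) k +ℤ_) (intervalSum-blocks f k (suc a) m) ⟩
  intervalSum (λ j → intervalSum f (k * j) k) a (suc m) ∎

intervalSum-cong : ∀ f g a m → (∀ k → a ≤ k → f k ≡ g k) → intervalSum f a m ≡ intervalSum g a m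
intervalSum-cong f g a zero    f≗g = refl
intervalSum-cong f g a (suc m) f≗g =
  cong₂ _+ℤ_ (f≗g a ℕₚ.≤-refl)
    (intervalSum-cong f g (suc a) m (λ k 1+a≤k → f≗g k (ℕₚ.≤-trans (ℕₚ.n≤1+n a) 1+a≤k)))

intervalSum-linear : ∀ c d f g a m →
  intervalSum (λ k → c *ℤ f k -ℤ d *ℤ g k) a m ≡ c *ℤ intervalSum f a m -ℤ d *ℤ intervalSum g a m
intervalSum-linear c d f g a zero    = annihilate c d
  where
  annihilate : ∀ c d → + 0 ≡ c *ℤ + 0 -ℤ d *ℤ + 0
  annihilate = solve-∀
intervalSum-linear c d f g a (suc m) =
  trans (cong ((c *ℤ f a -ℤ d *ℤ g a) +ℤ_) (intervalSum-linear c d f g (suc a) m))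
        (distribute c d (f a) (g a) (intervalSum f (suc a) m) (intervalSum g (suc a) m))
  where
  distribute : ∀ c d x y X Y →
    (c *ℤ x -ℤ d *ℤ y) +ℤ (c *ℤ X -ℤ d *ℤ Y) ≡ c *ℤ (x +ℤ X) -ℤ d *ℤ (y +ℤ Y)
  distribute = solve-∀

intervalSum-2 : ∀ f a → intervalSum f a 2 ≡ f a +ℤ f (a + 1)
intervalSum-2 f a = cong (f a +ℤ_) (trans (ℤₚ.+-identityʳ _) (cong f (ℕₚ.+-comm 1 a)))

intervalSum-4 : ∀ f a → intervalSum f a 4 ≡ f a +ℤ f (a + 1) +ℤ f (a + 2) +ℤ f (a + 3)
intervalSum-4 f a = begin
  f a +ℤ (f (1 + a) +ℤ (f (2 + a) +ℤ (f (3 + a) +ℤ + 0)))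
    ≡⟨ reassociate (f a) (f (1 + a)) (f (2 + a)) (f (3 + a)) ⟩
  f a +ℤ f (1 + a) +ℤ f (2 + a) +ℤ f (3 + a)
    ≡⟨ cong₂ _+ℤ_ (cong₂ _+ℤ_ (cong (f a +ℤ_) (swap 1)) (swap 2)) (swap 3) ⟩
  f a +ℤ f (a + 1) +ℤ f (a + 2) +ℤ f (a + 3) ∎
  where
  reassociate : ∀ w x y z → w +ℤ (x +ℤ (y +ℤ (z +ℤ + 0))) ≡ w +ℤ x +ℤ y +ℤ z
  reassociate = solve-∀
  swap : ∀ i → f (i + a) ≡ f (a + i)
  swap i = cong f (ℕₚ.+-comm i a)

record LinearRecurrence (p q : ℤ) (x : ℕ → ℤ) : Set where
  constructor linearRecurrence
  field step : ∀ n → x (suc (suc n)) ≡ p *ℤ x (suc n) -ℤ q *ℤ x n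

linearRecurrence-unique : ∀ {p q x y} → LinearRecurrence p q x → LinearRecurrence p q y →
  x 0 ≡ y 0 → x 1 ≡ y 1 → ∀ n → x n ≡ y n
linearRecurrence-unique {p} {q} {x} {y} (linearRecurrence rx) (linearRecurrence ry) e₀ e₁ n =
  proj₁ (agree n)
  where
  agree : ∀ n → x n ≡ y n × x (suc n) ≡ y (suc n)
  agree zero    = e₀ , e₁
  agree (suc n) with agree n
  ... | eₙ , eₙ₊₁ = eₙ₊₁ , trans (rx n) (trans (cong₂ (λ u v → p *ℤ u -ℤ q *ℤ v) eₙ₊₁ eₙ) (sym (ry n)))

linearRecurrence-*ˡ : ∀ {p q x} c → LinearRecurrence p q x → LinearRecurrence p q (λ n → c *ℤ x n)
linearRecurrence-*ˡ {p} {q} {x} c (linearRecurrence rx) = linearRecurrence λ n →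
  trans (cong (c *ℤ_) (rx n)) (scale c p q (x (suc n)) (x n))
  where
  scale : ∀ c p q u v → c *ℤ (p *ℤ u -ℤ q *ℤ v) ≡ p *ℤ (c *ℤ u) -ℤ q *ℤ (c *ℤ v)
  scale = solve-∀

linearRecurrence-geometric : ∀ {p q x} c → LinearRecurrence p q x →
  LinearRecurrence (+ c *ℤ p) (+ c *ℤ + c *ℤ q) (λ n → x n *ℤ + (c ^ n))
linearRecurrence-geometric {p} {q} {x} c (linearRecurrence rx) = linearRecurrence λ n → begin
  x (2 + n) *ℤ + (c * (c * c ^ n))
    ≡⟨ cong₂ _*ℤ_ (rx n) (trans (ℤₚ.pos-* c (c * c ^ n)) (cong (+ c *ℤ_) (ℤₚ.pos-* c (c ^ n)))) ⟩
  (p *ℤ x (1 + n) -ℤ q *ℤ x n) *ℤ (+ c *ℤ (+ c *ℤ + (c ^ n)))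
    ≡⟨ distribute p q (x (1 + n)) (x n) (+ c) (+ (c ^ n)) ⟩
  + c *ℤ p *ℤ (x (1 + n) *ℤ (+ c *ℤ + (c ^ n))) -ℤ + c *ℤ + c *ℤ q *ℤ (x n *ℤ + (c ^ n))
    ≡⟨ cong (λ z → + c *ℤ p *ℤ (x (1 + n) *ℤ z) -ℤ + c *ℤ + c *ℤ q *ℤ (x n *ℤ + (c ^ n)))
            (sym (ℤₚ.pos-* c (c ^ n))) ⟩
  + c *ℤ p *ℤ (x (1 + n) *ℤ + (c * c ^ n)) -ℤ + c *ℤ + c *ℤ q *ℤ (x n *ℤ + (c ^ n)) ∎
  where
  distribute : ∀ p q u v C P →
    (p *ℤ u -ℤ q *ℤ v) *ℤ (C *ℤ (C *ℤ P)) ≡ C *ℤ p *ℤ (u *ℤ (C *ℤ P)) -ℤ C *ℤ C *ℤ q *ℤ (v *ℤ P)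
  distribute = solve-∀

conj : ℤ√17 → ℤ√17
conj x = mk√ (re x) (-ℤ im x)

conj-⊛ : ∀ x y → conj (x ⊛ y) ≡ conj x ⊛ conj y
conj-⊛ x y = cong₂ mk√ (real-part (re x) (im x) (re y) (im y)) (√17-part (re x) (im x) (re y) (im y))
  where
  real-part : ∀ a b c d → a *ℤ c +ℤ + 17 *ℤ (b *ℤ d) ≡ a *ℤ c +ℤ + 17 *ℤ (-ℤ b *ℤ -ℤ d)
  real-part = solve-∀
  √17-part : ∀ a b c d → -ℤ (a *ℤ d +ℤ b *ℤ c) ≡ a *ℤ -ℤ d +ℤ -ℤ b *ℤ c
  √17-part = solve-∀

conj-^√ : ∀ x n → conj (x ^√ n) ≡ conj x ^√ n
conj-^√ x zero    = refl
conj-^√ x (suc n) = trans (conj-⊛ x (x ^√ n)) (cong (conj x ⊛_) (conj-^√ x n))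

-- Cayley–Hamilton: mk√ a b is a root of X² − 2a X + (a² − 17 b²).
im-^√-recurrence : ∀ a b →
  LinearRecurrence (+ 2 *ℤ a) (a *ℤ a -ℤ + 17 *ℤ (b *ℤ b)) (λ n → im (mk√ a b ^√ n))
im-^√-recurrence a b = linearRecurrence λ n → cayley-hamilton a b (re (mk√ a b ^√ n)) (im (mk√ a b ^√ n))
  where
  cayley-hamilton : ∀ a b c d →
    a *ℤ (a *ℤ d +ℤ b *ℤ c) +ℤ b *ℤ (a *ℤ c +ℤ + 17 *ℤ (b *ℤ d))
      ≡ + 2 *ℤ a *ℤ (a *ℤ d +ℤ b *ℤ c) -ℤ (a *ℤ a -ℤ + 17 *ℤ (b *ℤ b)) *ℤ d
  cayley-hamilton = solve-∀

difference-with-conj : ∀ S P x → S *ℤ P ≡ + 4 *ℤ im x →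
  ι S ⊛ ι (P *ℤ P) ⊛ √17 ≡ ι (+ 2 *ℤ P) ⊛ (x ⊖ conj x)
difference-with-conj S P x SP≡4im = cong₂ mk√ (real-part S P (re x) (im x)) (begin
  (S *ℤ (P *ℤ P) +ℤ + 17 *ℤ (+ 0 *ℤ + 0)) *ℤ + 1 +ℤ (S *ℤ + 0 +ℤ + 0 *ℤ (P *ℤ P)) *ℤ + 0
    ≡⟨ collect S P ⟩
  S *ℤ P *ℤ P
    ≡⟨ cong (_*ℤ P) SP≡4im ⟩
  + 4 *ℤ im x *ℤ P
    ≡⟨ spread P (re x) (im x) ⟩
  + 2 *ℤ P *ℤ (im x +ℤ -ℤ (-ℤ im x)) +ℤ + 0 *ℤ (re x +ℤ -ℤ re x) ∎)
  where
  real-part : ∀ S P a b →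
    (S *ℤ (P *ℤ P) +ℤ + 17 *ℤ (+ 0 *ℤ + 0)) *ℤ + 0 +ℤ + 17 *ℤ ((S *ℤ + 0 +ℤ + 0 *ℤ (P *ℤ P)) *ℤ + 1)
      ≡ + 2 *ℤ P *ℤ (a +ℤ -ℤ a) +ℤ + 17 *ℤ (+ 0 *ℤ (b +ℤ -ℤ (-ℤ b)))
  real-part = solve-∀
  collect : ∀ S P →
    (S *ℤ (P *ℤ P) +ℤ + 17 *ℤ (+ 0 *ℤ + 0)) *ℤ + 1 +ℤ (S *ℤ + 0 +ℤ + 0 *ℤ (P *ℤ P)) *ℤ + 0 ≡ S *ℤ P *ℤ P
  collect = solve-∀
  spread : ∀ P a b → + 4 *ℤ b *ℤ P ≡ + 2 *ℤ P *ℤ (b +ℤ -ℤ (-ℤ b)) +ℤ + 0 *ℤ (a +ℤ -ℤ a)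
  spread = solve-∀

dyadicSum : (ℕ → ℤ) → ℕ → ℤ
dyadicSum s n = intervalSum s (2 ^ n) (2 ^ n)

module _ (s : ℕ → ℤ)
    (s-4k   : ∀ k → k ≥ 1 → s (4 * k) ≡ (+ 2 *ℤ s (2 * k)) -ℤ s k)
    (s-4k+1 : ∀ k → k ≥ 1 → s (4 * k + 1) ≡ (+ 2 *ℤ s (2 * k)) +ℤ s (2 * k + 1))
    (s-4k+2 : ∀ k → k ≥ 1 → s (4 * k + 2) ≡ (+ 2 *ℤ s (2 * k + 1)) +ℤ s (2 * k))
    (s-4k+3 : ∀ k → k ≥ 1 → s (4 * k + 3) ≡ (+ 2 *ℤ s (2 * k + 1)) -ℤ s k) where

  quadrupleSum : ∀ k → k ≥ 1 → intervalSum s (4 * k) 4 ≡ + 5 *ℤ intervalSum s (2 * k) 2 -ℤ + 2 *ℤ s k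
  quadrupleSum k k≥1 = begin
    intervalSum s (4 * k) 4
      ≡⟨ intervalSum-4 s (4 * k) ⟩
    s (4 * k) +ℤ s (4 * k + 1) +ℤ s (4 * k + 2) +ℤ s (4 * k + 3)
      ≡⟨ cong₂ _+ℤ_ (cong₂ _+ℤ_ (cong₂ _+ℤ_ (s-4k k k≥1) (s-4k+1 k k≥1)) (s-4k+2 k k≥1)) (s-4k+3 k k≥1) ⟩
    (+ 2 *ℤ A -ℤ C) +ℤ (+ 2 *ℤ A +ℤ B) +ℤ (+ 2 *ℤ B +ℤ A) +ℤ (+ 2 *ℤ B -ℤ C)
      ≡⟨ collect A B C ⟩
    + 5 *ℤ (A +ℤ B) -ℤ + 2 *ℤ C
      ≡⟨ cong (λ z → + 5 *ℤ z -ℤ + 2 *ℤ C) (sym (intervalSum-2 s (2 * k))) ⟩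
    + 5 *ℤ intervalSum s (2 * k) 2 -ℤ + 2 *ℤ C ∎
    where
    A = s (2 * k)
    B = s (2 * k + 1)
    C = s k
    collect : ∀ A B C → (+ 2 *ℤ A -ℤ C) +ℤ (+ 2 *ℤ A +ℤ B) +ℤ (+ 2 *ℤ B +ℤ A) +ℤ (+ 2 *ℤ B -ℤ C)
      ≡ + 5 *ℤ (A +ℤ B) -ℤ + 2 *ℤ C
    collect = solve-∀

  dyadicSum-recurrence : LinearRecurrence (+ 5) (+ 2) (dyadicSum s)
  dyadicSum-recurrence = linearRecurrence quadrupled
    where
    quadrupled : ∀ n → dyadicSum s (2 + n) ≡ + 5 *ℤ dyadicSum s (1 + n) -ℤ + 2 *ℤ dyadicSum s n
    quadrupled n = begin
      intervalSum s (2 * (2 * N)) (2 * (2 * N))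
        ≡⟨ cong (λ b → intervalSum s b b) (sym (ℕₚ.*-assoc 2 2 N)) ⟩
      intervalSum s (4 * N) (4 * N)
        ≡⟨ intervalSum-blocks s 4 N N ⟩
      intervalSum (λ k → intervalSum s (4 * k) 4) N N
        ≡⟨ intervalSum-cong _ _ N N (λ k N≤k → quadrupleSum k (ℕₚ.≤-trans (ℕₚ.m^n>0 2 n) N≤k)) ⟩
      intervalSum (λ k → + 5 *ℤ intervalSum s (2 * k) 2 -ℤ + 2 *ℤ s k) N N
        ≡⟨ intervalSum-linear (+ 5) (+ 2) _ s N N ⟩
      + 5 *ℤ intervalSum (λ k → intervalSum s (2 * k) 2) N N -ℤ + 2 *ℤ dyadicSum s n
        ≡⟨ cong (λ z → + 5 *ℤ z -ℤ + 2 *ℤ dyadicSum s n) (sym (intervalSum-blocks s 2 N N)) ⟩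
      + 5 *ℤ dyadicSum s (suc n) -ℤ + 2 *ℤ dyadicSum s n ∎
      where
      N = 2 ^ n

proposition7 : (s : ℕ → ℤ)
    → s 1 ≡ Data.Integer.+ 0
    → s 2 ≡ Data.Integer.+ 1
    → s 3 ≡ Data.Integer.+ 1
    → (∀ k → k ≥ 1 → s (4 * k) ≡ (Data.Integer.+ 2 *ℤ s (2 * k)) -ℤ s k)
    → (∀ k → k ≥ 1 → s (4 * k + 1) ≡ (Data.Integer.+ 2 *ℤ s (2 * k)) +ℤ s (2 * k + 1))
    → (∀ k → k ≥ 1 → s (4 * k + 2) ≡ (Data.Integer.+ 2 *ℤ s (2 * k + 1)) +ℤ s (2 * k))
    → (∀ k → k ≥ 1 → s (4 * k + 3) ≡ (Data.Integer.+ 2 *ℤ s (2 * k + 1)) -ℤ s k)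
    → ∀ (n : ℕ)
    → ι (rangeSum s (2 ^ n) (2 ^ n)) ⊛ ι (Data.Integer.+ (2 ^ (2 * n))) ⊛ √17
      ≡ ι (Data.Integer.+ (2 ^ (n + 1)))
        ⊛ (((mk√ (Data.Integer.+ 5) (Data.Integer.+ 1)) ^√ n)
           ⊖ ((mk√ (Data.Integer.+ 5) (Data.Integer.-[1+ 0 ])) ^√ n))
proposition7 s s₁ s₂ s₃ s-4k s-4k+1 s-4k+2 s-4k+3 n = begin
  ι (rangeSum s N N) ⊛ ι (+ (2 ^ (2 * n))) ⊛ √17
    ≡⟨ cong₂ (λ S Q → ι S ⊛ ι Q ⊛ √17) (rangeSum≡intervalSum s N N) 4^n≡2^n*2^n ⟩
  ι (dyadicSum s n) ⊛ ι (+ N *ℤ + N) ⊛ √17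
    ≡⟨ difference-with-conj (dyadicSum s n) (+ N) (α ^√ n) (scaled-sums≡4im n) ⟩
  ι (+ 2 *ℤ + N) ⊛ (α ^√ n ⊖ conj (α ^√ n))
    ≡⟨ cong₂ (λ Q y → ι Q ⊛ (α ^√ n ⊖ y)) (sym 2^[n+1]≡2*2^n) (conj-^√ α n) ⟩
  ι (+ (2 ^ (n + 1))) ⊛ (α ^√ n ⊖ conj α ^√ n) ∎
  where
  N = 2 ^ n
  α = mk√ (+ 5) (+ 1)
  scaled-sums≡4im : ∀ n → dyadicSum s n *ℤ + (2 ^ n) ≡ + 4 *ℤ im (α ^√ n)
  scaled-sums≡4im = linearRecurrence-unique
    (linearRecurrence-geometric 2 (dyadicSum-recurrence s s-4k s-4k+1 s-4k+2 s-4k+3))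
    (linearRecurrence-*ˡ (+ 4) (im-^√-recurrence (+ 5) (+ 1)))
    (cong (λ v → (v +ℤ + 0) *ℤ + 1) s₁)
    (cong₂ (λ u v → (u +ℤ (v +ℤ + 0)) *ℤ + 2) s₂ s₃)
  4^n≡2^n*2^n : + (2 ^ (2 * n)) ≡ + N *ℤ + N
  4^n≡2^n*2^n = trans (cong (λ m → + (2 ^ (n + m))) (ℕₚ.+-identityʳ n))
    (trans (cong +_ (ℕₚ.^-distribˡ-+-* 2 n n)) (ℤₚ.pos-* N N))
  2^[n+1]≡2*2^n : + (2 ^ (n + 1)) ≡ + 2 *ℤ + N
  2^[n+1]≡2*2^n = trans (cong (λ m → + (2 ^ m)) (ℕₚ.+-comm n 1)) (ℤₚ.pos-* 2 N)
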